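{- Let $c_1, c_2$ be rational numbers with $0 \le c_1, c_2 \le 1$, and let $c=\min\{c_1,c_2\}$. If $\frac{1-c_1-c_2}{c(2-c_1-c_2)} \ge 1$, then there exists an infinite family of $(c_1,c_2)$-mixed graphs $G_m$ such that each $G_m$, of order $n$, satisfies $$\delta(G_m) \ge \frac{1}{2-c_1-c_2}\, n + \frac{2}{2-c_1-c_2}\cdot\frac{\ln n}{2\ln \frac{27}{4}},$$ and the oriented diameter of $G_m$ is at least three (i.e., no orientation of $G_m$ has diameter at most $2$).
   Context: A mixed graph $G$ has a finite vertex set $V(G)$ and an edge set $E(G)$ consisting of undirected edges $xy$ and directed edges (arcs) $\overrightarrow{xy}$; there are no loops and no parallel edges. For $x \in V(G)$: $N^+_G(x)=\{y : \overrightarrow{xy}\in E(G)\}$, $N^-_G(x)=\{y:\overrightarrow{yx}\in E(G)\}$, $N^0_G(x)=\{y: xy\in E(G)\}$, $N_G(x)=N^+_G(x)\cup N^-_G(x)\cup N^0_G(x)$; the degree is $d_G(x)=|N_G(x)|$, the out-degree $d^+_G(x)=|N^+_G(x)|$, the in-degree $d^-_G(x)=|N^-_G(x)|$, and $\delta(G)$ is the minimum degree. For rational numbers $0\le c_1,c_2\le 1$, $G$ is a $(c_1,c_2)$-mixed graph if $d^+_G(u)\le c_1 d_G(u)$ and $d^-_G(u)\le c_2 d_G(u)$ for every $u\in V(G)$. An orientation of $G$ is a directed graph obtained by assigning a direction to every undirected edge of $G$ (directed edges keep their direction). The oriented diameter of $G$ is the minimum, over all strongly connected orientations $D$ of $G$,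 of the diameter of $D$ (the maximum over ordered pairs of distinct vertices $(u,v)$ of the length of a shortest directed path from $u$ to $v$ in $D$). -}

module Defs where

open import Data.Bool using (Bool; true; false; if_then_else_; _∨_)
open import Data.Nat as ℕ using (ℕ; suc; _^_)
open import Data.Integer as ℤ using (+_; ∣_∣)
open import Data.Rational as ℚ using (ℚ; _/_; ↥_; ↧ₙ_; _≤_; _<_; 0ℚ)
open import Data.Fin using (Fin)
open import Data.List using (List; map; allFin)
open import Data.Nat.ListAction using (sum)
open import Data.Product using (Σ; ∃; _×_)
open import Relation.Binary.PropositionalEquality using (_≡_; _≢_)
open import Relation.Nullary using (¬_)

⟦_⟧ : ℕ → ℚ
⟦ k ⟧ = + k / 1

countB : {n : ℕ} → (Fin n → Bool) → ℕ
countB {n} f = sum (map (λ y → if f y then 1 else 0) (allFin n))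

-- A mixed graph on vertex set Fin n.
-- und x y : undirected edge xy ; arc x y : directed edge from x to y.
record MixedGraph (n : ℕ) : Set where
  field
    und        : Fin n → Fin n → Bool
    arc        : Fin n → Fin n → Bool
    und-sym    : ∀ x y → und x y ≡ und y x
    und-irrefl : ∀ x → und x x ≡ false
    arc-irrefl : ∀ x → arc x x ≡ false
    arc-asym   : ∀ x y → arc x y ≡ true → arc y x ≡ false
    und-noarc  : ∀ x y → und x y ≡ true → arc x y ≡ false

module _ {n : ℕ} (G : MixedGraph n) where
  open MixedGraph G

  outDeg : Fin n → ℕ
  outDeg x = countB (λ y → arc x y)

  inDeg : Fin n → ℕ
  inDeg x = countB (λ y → arc y x)

  deg : Fin n → ℕ
  deg x = countB (λ y → und x y ∨ arc x y ∨ arc y x)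

  IsMixed : ℚ → ℚ → Set
  IsMixed c₁ c₂ = ∀ u → (⟦ outDeg u ⟧ ≤ c₁ ℚ.* ⟦ deg u ⟧) × (⟦ inDeg u ⟧ ≤ c₂ ℚ.* ⟦ deg u ⟧)

  IsOrientation : (Fin n → Fin n → Bool) → Set
  IsOrientation D =
    (∀ x y → arc x y ≡ true → D x y ≡ true) ×
    (∀ x y → und x y ≡ true → (D x y ≡ true × D y x ≡ false) Data.Sum.⊎ (D x y ≡ false × D y x ≡ true)) ×
    (∀ x y → D x y ≡ true → (und x y ≡ true) Data.Sum.⊎ (arc x y ≡ true))
    where import Data.Sum

data Walk {n : ℕ} (D : Fin n → Fin n → Bool) : Fin n → Fin n → ℕ → Set where
  done : ∀ {u} → Walk D u u 0
  step : ∀ {u w v k} → D u w ≡ true → Walk D w v k → Walk D u v (suc k)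

DiamLe2 : {n : ℕ} → (Fin n → Fin n → Bool) → Set
DiamLe2 {n} D = ∀ (u v : Fin n) → u ≢ v → ∃ λ k → (k ℕ.≤ 2) × Walk D u v k

OrientedDiamGe3 : {n : ℕ} → MixedGraph n → Set
OrientedDiamGe3 G = ∀ D → IsOrientation G D → ¬ DiamLe2 D

-- GeLog x m  :⇔  x ≥ ln m / ln (27/4), i.e. (27/4)^x ≥ m  (for m ≥ 1).
-- Writing x = p/q in lowest terms (q > 0): this holds iff x ≥ 0 and m^q · 4^p ≤ 27^p.
GeLog : ℚ → ℕ → Set
GeLog x m = (0ℚ ≤ x) × (m ^ (↧ₙ x) ℕ.* 4 ^ ∣ ↥ x ∣ ℕ.≤ 27 ^ ∣ ↥ x ∣)

-- δ(G) ≥ n/(2-c₁-c₂) + (2/(2-c₁-c₂)) · ln n / (2 ln (27/4))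
-- ⇔ (since 2-c₁-c₂ > 0) every vertex u satisfies (2-c₁-c₂)·d(u) - n ≥ ln n / ln(27/4)
MinDegBound : {n : ℕ} → MixedGraph n → ℚ → ℚ → Set
MinDegBound {n} G c₁ c₂ = ∀ u → GeLog ((⟦ 2 ⟧ ℚ.- c₁ ℚ.- c₂) ℚ.* ⟦ deg G u ⟧ ℚ.- ⟦ n ⟧) n

{-# OPTIONS --safe #-}
module Submission where

-- Write c₁ = a₁/q and c₂ = a₂/q with q = a₁ + a₂ + s and s ≥ 1, which is possible as c₁ + c₂ < 1.
-- The graph is a blow-up of seven cliques: a hub v; a block A of odd size k = 2t + 1; a block X
-- with one vertex for each 2-colouring of A, adjacent to the vertices of A of the majority colour;
-- W⁺ receiving arcs from v and X; W⁻ sending arcs to v and X; B joined to everything but X; and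
-- F joined to everything but v. The only common neighbours of v and X outside A are reached by
-- arcs that cannot be traversed one after the other, so in an orientation every route of length
-- two between v and X passes through A. Colour A by the direction of its edges at v: the vertex
-- of X belonging to this colouring sees a single colour class of A, so either it cannot reach v
-- in two steps or v cannot reach it.
-- In units of M = k + 2^k every vertex has degree at least qM, at most a₁M out-arcs and at most
-- a₂M in-arcs, and n + u = (q + s)M where t = u + 1. As (2 - c₁ - c₂)q = q + s, this gives
-- (2 - c₁ - c₂)δ - n ≥ u, and u = 2K with K ≥ 16(q + s) makes n ≤ K·4^u ≤ (27/4)^u.

open import Defs

-- A module of its own keeps ℕ's _≤_, _<_ and _*_ from clashing with the ℚ operators used below.
module Combinatorics where

  open import Data.Bool using (Bool; true; false; not; _∧_; _∨_; if_then_else_)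
  open import Data.Bool.Properties using (∨-comm; ∧-comm; ∧-identityʳ)
  open import Data.Empty using (⊥; ⊥-elim)
  open import Data.Fin using (Fin; zero; suc; splitAt; _≟_; finToFun; funToFin)
  open import Data.Fin.Properties using (finToFun-funToFin; 2↔Bool; 1↔⊤; +↔⊎)
  open import Data.List using (map; allFin)
  open import Data.List.Properties using (map-tabulate; map-cong)
  open import Data.Nat using (ℕ; zero; suc; _+_; _*_; _^_; _∸_; _≤_; _<_; z≤n; s≤s; _≤?_; _≡ᵇ_)
  open import Data.Nat.ListAction using (sum)
  open import Data.Nat.Properties hiding (_≟_)
  open import Data.Nat.Tactic.RingSolver using (solve-∀)
  open import Data.Product using (∃-syntax; _×_; _,_; proj₁; proj₂)
  open import Data.Sum as Sum using (_⊎_; inj₁; inj₂)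
  open import Data.Sum.Function.Propositional using (_⊎-↔_)
  open import Data.Unit using (⊤; tt)
  open import Function using (_∘_; id)
  open import Function.Bundles using (Inverse; _↔_)
  open import Function.Properties.Inverse using (↔-refl; ↔-trans)
  open import Relation.Binary.PropositionalEquality
  open import Relation.Nullary using (¬_; Dec; yes; no; does)

  𝟙 : Bool → ℕ
  𝟙 b = if b then 1 else 0

  𝟙≤1 : ∀ b → 𝟙 b ≤ 1
  𝟙≤1 true  = ≤-refl
  𝟙≤1 false = z≤n

  countB-suc : ∀ {n} (f : Fin (suc n) → Bool) → countB f ≡ 𝟙 (f zero) + countB (f ∘ suc)
  countB-suc f = cong (λ xs → 𝟙 (f zero) + sum xs)
    (trans (map-tabulate suc (𝟙 ∘ f)) (sym (map-tabulate id (𝟙 ∘ f ∘ suc))))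

  countB-cong : ∀ {n} {f g : Fin n → Bool} → f ≗ g → countB f ≡ countB g
  countB-cong {n} f≗g = cong sum (map-cong (cong 𝟙 ∘ f≗g) (allFin n))

  countB-mono : ∀ {n} {f g : Fin n → Bool} → (∀ y → f y ≡ true → g y ≡ true) → countB f ≤ countB g
  countB-mono {zero}          f⇒g = z≤n
  countB-mono {suc n} {f} {g} f⇒g = begin
    countB f                     ≡⟨ countB-suc f ⟩
    𝟙 (f zero) + countB (f ∘ suc) ≤⟨ +-mono-≤ (𝟙-mono (f⇒g zero)) (countB-mono (f⇒g ∘ suc)) ⟩
    𝟙 (g zero) + countB (g ∘ suc) ≡⟨ countB-suc g ⟨
    countB g                     ∎
    where
    open ≤-Reasoning
    𝟙-mono : ∀ {b c} → (b ≡ true → c ≡ true) → 𝟙 b ≤ 𝟙 c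
    𝟙-mono {false}         _   = z≤n
    𝟙-mono {true}  {true}  _   = ≤-refl
    𝟙-mono {true}  {false} b⇒c with () ← b⇒c refl

  countB-all : ∀ {n} {f : Fin n → Bool} → (∀ y → f y ≡ true) → countB f ≡ n
  countB-all {zero}  all = refl
  countB-all {suc n} {f} all rewrite countB-suc f | all zero = cong suc (countB-all (all ∘ suc))

  countB-none : ∀ {n} {f : Fin n → Bool} → (∀ y → f y ≡ false) → countB f ≡ 0
  countB-none {zero}  none = refl
  countB-none {suc n} {f} none rewrite countB-suc f | none zero = countB-none (none ∘ suc)

  countB-≤ : ∀ n {f : Fin n → Bool} → countB f ≤ n
  countB-≤ n {f} = ≤-trans (countB-mono {n} {f} {λ _ → true} (λ _ _ → refl)) (≤-reflexive (countB-all {n} (λ _ → refl)))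

  countB-splitAt : ∀ m {n} (h : Fin m ⊎ Fin n → Bool) →
    countB (h ∘ splitAt m) ≡ countB (h ∘ inj₁) + countB (h ∘ inj₂)
  countB-splitAt zero    h = refl
  countB-splitAt (suc m) h = begin
    countB (h ∘ splitAt (suc m))
      ≡⟨ countB-suc (h ∘ splitAt (suc m)) ⟩
    𝟙 (h (inj₁ zero)) + countB (h ∘ Sum.map suc id ∘ splitAt m)
      ≡⟨ cong (𝟙 (h (inj₁ zero)) +_) (countB-splitAt m (h ∘ Sum.map suc id)) ⟩
    𝟙 (h (inj₁ zero)) + (countB (h ∘ inj₁ ∘ suc) + countB (h ∘ inj₂))
      ≡⟨ +-assoc (𝟙 (h (inj₁ zero))) _ _ ⟨
    (𝟙 (h (inj₁ zero)) + countB (h ∘ inj₁ ∘ suc)) + countB (h ∘ inj₂)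
      ≡⟨ cong (_+ countB (h ∘ inj₂)) (countB-suc (h ∘ inj₁)) ⟨
    countB (h ∘ inj₁) + countB (h ∘ inj₂) ∎
    where open ≡-Reasoning

  countB-not : ∀ {n} (f : Fin n → Bool) → countB f + countB (not ∘ f) ≡ n
  countB-not {zero}  f = refl
  countB-not {suc n} f rewrite countB-suc f | countB-suc (not ∘ f) with f zero
  ... | true  = cong suc (countB-not (f ∘ suc))
  ... | false = trans (+-suc _ _) (cong suc (countB-not (f ∘ suc)))

  distinct : ∀ {n} → Fin n → Fin n → Bool
  distinct x y = not (does (x ≟ y))

  distinct-sym : ∀ {n} (x y : Fin n) → distinct x y ≡ distinct y x
  distinct-sym zero    zero    = refl
  distinct-sym zero    (suc y) = refl
  distinct-sym (suc x) zero    = refl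
  distinct-sym (suc x) (suc y) = distinct-sym x y

  distinct-irrefl : ∀ {n} (x : Fin n) → distinct x x ≡ false
  distinct-irrefl zero    = refl
  distinct-irrefl (suc x) = distinct-irrefl x

  distinct-≢ : ∀ {n} {x y : Fin n} → x ≢ y → distinct x y ≡ true
  distinct-≢ {x = x} {y} x≢y with x ≟ y
  ... | yes x≡y = ⊥-elim (x≢y x≡y)
  ... | no  _   = refl

  countB-distinct : ∀ {n} (x : Fin n) (f : Fin n → Bool) → countB f ≤ suc (countB (λ y → distinct x y ∧ f y))
  countB-distinct {suc n} zero f rewrite countB-suc f | countB-suc (λ y → distinct zero y ∧ f y) =
    +-monoˡ-≤ (countB (f ∘ suc)) (𝟙≤1 (f zero))
  countB-distinct {suc n} (suc x) f rewrite countB-suc f | countB-suc (λ y → distinct (suc x) y ∧ f y) =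
    ≤-trans (+-monoʳ-≤ (𝟙 (f zero)) (countB-distinct x (f ∘ suc))) (≤-reflexive (+-suc _ _))

  majority : ∀ t → (Fin (suc (t + t)) → Bool) → Bool
  majority t s = does (suc t ≤? countB s)

  agrees : ∀ t → (Fin (suc (t + t)) → Bool) → Fin (suc (t + t)) → Bool
  agrees t s a = if majority t s then s a else not (s a)

  countB-agrees : ∀ t (s : Fin (suc (t + t)) → Bool) → suc t ≤ countB (agrees t s)
  countB-agrees t s = by-majority (suc t ≤? countB s)
    where
    by-majority : (m : Dec (suc t ≤ countB s)) → suc t ≤ countB (λ a → if does m then s a else not (s a))
    by-majority (yes t<s) = t<s
    by-majority (no  t≮s) = +-cancelˡ-≤ (countB s) _ _ (begin
      countB s + suc t              ≤⟨ +-monoˡ-≤ (suc t) (≤-pred (≰⇒> t≮s)) ⟩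
      t + suc t                     ≡⟨ +-suc t t ⟩
      suc (t + t)                   ≡⟨ countB-not s ⟨
      countB s + countB (not ∘ s)   ∎)
      where open ≤-Reasoning

  agrees⇒≡majority : ∀ t s a → agrees t s a ≡ true → s a ≡ majority t s
  agrees⇒≡majority t s a = by-majority (majority t s) (s a)
    where
    by-majority : ∀ m b → (if m then b else not b) ≡ true → b ≡ m
    by-majority true  b     b≡true = b≡true
    by-majority false false _      = refl

  majority-cong : ∀ t {s s′} → s ≗ s′ → majority t s ≡ majority t s′
  majority-cong t s≗s′ = cong (λ c → does (suc t ≤? c)) (countB-cong s≗s′)

  bits : ∀ {k} → Fin (2 ^ k) → Fin k → Bool
  bits i a = Inverse.to 2↔Bool (finToFun i a)

  code : ∀ {k} → (Fin k → Bool) → Fin (2 ^ k)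
  code s = funToFin (Inverse.from 2↔Bool ∘ s)

  bits-code : ∀ {k} (s : Fin k → Bool) a → bits (code s) a ≡ s a
  bits-code s a = trans (cong (Inverse.to 2↔Bool) (finToFun-funToFin _ a)) (Inverse.strictlyInverseˡ 2↔Bool (s a))

  short-walk : ∀ {n} {D : Fin n → Fin n → Bool} {x y k} → k ≤ 2 → Walk D x y k →
    x ≡ y ⊎ D x y ≡ true ⊎ ∃[ w ] D x w ≡ true × D w y ≡ true
  short-walk _                done                       = inj₁ refl
  short-walk _                (step xy done)             = inj₂ (inj₁ xy)
  short-walk _                (step xw (step wy done))   = inj₂ (inj₂ (_ , xw , wy))
  short-walk (s≤s (s≤s ()))   (step _ (step _ (step _ _)))

  far-apart⇒¬DiamLe2 : ∀ {n} {D : Fin n → Fin n → Bool} {x y} → x ≢ y → D x y ≢ true →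
    (∀ w → D x w ≡ true → D w y ≡ true → ⊥) → ¬ DiamLe2 D
  far-apart⇒¬DiamLe2 {x = x} {y} x≢y ¬xy ¬xwy diam with diam x y x≢y
  ... | k , k≤2 , walk with short-walk k≤2 walk
  ...   | inj₁ x≡y               = x≢y x≡y
  ...   | inj₂ (inj₁ xy)         = ¬xy xy
  ...   | inj₂ (inj₂ (w , xw , wy)) = ¬xwy w xw wy

  _⊕_ : ∀ {m m′} {A B : Set} → Fin m ↔ A → Fin m′ ↔ B → Fin (m + m′) ↔ (A ⊎ B)
  e ⊕ f = ↔-trans +↔⊎ (e ⊎-↔ f)

  countB-⊕ : ∀ {m m′} {A B : Set} (e : Fin m ↔ A) (f : Fin m′ ↔ B) (h : A ⊎ B → Bool) →
    countB (h ∘ Inverse.to (e ⊕ f)) ≡ countB (h ∘ inj₁ ∘ Inverse.to e) + countB (h ∘ inj₂ ∘ Inverse.to f)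
  countB-⊕ {m} e f h = countB-splitAt m (h ∘ Sum.map (Inverse.to e) (Inverse.to f))

  -- Each class induces a clique, and towards c d turns the edges from class c to class d into arcs.
  module BlowUp {n : ℕ} {V : Set} (layout : Fin n ↔ V) (linked towards : V → V → Bool)
                (linked-sym : ∀ c d → linked c d ≡ linked d c)
                (towards-asym : ∀ c d → towards c d ≡ true → towards d c ≡ false) where

    class : Fin n → V
    class = Inverse.to layout

    vertex : V → Fin n
    vertex = Inverse.from layout

    class-vertex : ∀ c → class (vertex c) ≡ c
    class-vertex = Inverse.strictlyInverseˡ layout

    vertex-class : ∀ x → vertex (class x) ≡ x
    vertex-class = Inverse.strictlyInverseʳ layout

    undirected : V → V → Bool
    undirected c d = not (towards c d ∨ towards d c) ∧ linked c d

    passable : V → V → Bool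
    passable c d = towards c d ∨ undirected c d

    private
      undirected-sym : ∀ c d → undirected c d ≡ undirected d c
      undirected-sym c d = cong₂ (λ o l → not o ∧ l) (∨-comm (towards c d) (towards d c)) (linked-sym c d)

      towards-irrefl : ∀ c → towards c c ≡ false
      towards-irrefl c with towards c c in cc
      ... | false = refl
      ... | true  = trans (sym cc) (towards-asym c c cc)

      undirected⇒¬towards : ∀ e o o′ l → e ∧ (not (o ∨ o′) ∧ l) ≡ true → o ≡ false
      undirected⇒¬towards true false _ _ _ = refl

    graph : MixedGraph n
    graph = record
      { und        = λ x y → distinct x y ∧ undirected (class x) (class y)
      ; arc        = λ x y → towards (class x) (class y)
      ; und-sym    = λ x y → cong₂ _∧_ (distinct-sym x y) (undirected-sym (class x) (class y))
      ; und-irrefl = λ x → cong (_∧ undirected (class x) (class x)) (distinct-irrefl x)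
      ; arc-irrefl = λ x → towards-irrefl (class x)
      ; arc-asym   = λ x y → towards-asym (class x) (class y)
      ; und-noarc  = λ x y → undirected⇒¬towards (distinct x y) (towards (class x) (class y))
                                                  (towards (class y) (class x)) (linked (class x) (class y))
      }

    open MixedGraph graph using (und)

    linked-count≤deg : ∀ x → countB (λ y → linked (class x) (class y)) ≤ suc (deg graph x)
    linked-count≤deg x = ≤-trans (countB-distinct x (λ y → linked (class x) (class y)))
      (s≤s (countB-mono (λ y → adjacent (distinct x y) (linked (class x) (class y))
                                         (towards (class x) (class y)) (towards (class y) (class x)))))
      where
      adjacent : ∀ e l o o′ → e ∧ l ≡ true → (e ∧ (not (o ∨ o′) ∧ l)) ∨ o ∨ o′ ≡ true
      adjacent true true false false _ = refl
      adjacent true true false true  _ = refl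
      adjacent true true true  _     _ = refl

    vertex-injective : ∀ {c d} → vertex c ≡ vertex d → c ≡ d
    vertex-injective {c} {d} e = trans (sym (class-vertex c)) (trans (cong class e) (class-vertex d))

    und-vertex : ∀ {c d} → c ≢ d → undirected c d ≡ true → und (vertex c) (vertex d) ≡ true
    und-vertex {c} {d} c≢d cd =
      cong₂ _∧_ (distinct-≢ (c≢d ∘ vertex-injective)) (trans (cong₂ undirected (class-vertex c) (class-vertex d)) cd)

    module _ {D : Fin n → Fin n → Bool} (orientation : IsOrientation graph D) where

      passable-step : ∀ {x y} → D x y ≡ true → passable (class x) (class y) ≡ true
      passable-step {x} {y} xy with proj₂ (proj₂ orientation) x y xy
      ... | inj₁ und-xy = ∨-true (towards (class x) (class y)) (∧-true (distinct x y) und-xy)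
        where
        ∧-true : ∀ a {b} → a ∧ b ≡ true → b ≡ true
        ∧-true true b = b
        ∨-true : ∀ a {b} → b ≡ true → a ∨ b ≡ true
        ∨-true false b = b
        ∨-true true  _ = refl
      ... | inj₂ arc-xy = cong (_∨ undirected (class x) (class y)) arc-xy

      one-way : ∀ {c d} → c ≢ d → undirected c d ≡ true →
        D (vertex c) (vertex d) ≡ true → D (vertex d) (vertex c) ≡ true → ⊥
      one-way {c} {d} c≢d cd cd∈D dc∈D with proj₁ (proj₂ orientation) (vertex c) (vertex d) (und-vertex c≢d cd)
      ... | inj₁ (_ , dc∉D) with () ← trans (sym dc∉D) dc∈D
      ... | inj₂ (cd∉D , _) with () ← trans (sym cd∉D) cd∈D

  n<2^n : ∀ m → m < 2 ^ m
  n<2^n zero    = s≤s z≤n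
  n<2^n (suc m) = +-mono-≤ (m^n>0 2 m) (≤-trans (n<2^n m) (≤-reflexive (sym (+-identityʳ (2 ^ m)))))

  ^-distribʳ-* : ∀ m n o → (m * n) ^ o ≡ m ^ o * n ^ o
  ^-distribʳ-* m n zero    = refl
  ^-distribʳ-* m n (suc o) = trans (cong (m * n *_) (^-distribʳ-* m n o)) (interchange m n (m ^ o) (n ^ o))
    where
    interchange : ∀ a b c d → a * b * (c * d) ≡ a * c * (b * d)
    interchange = solve-∀

  k+2^k≤16*4^u : ∀ u → let k = suc (suc u + suc u) in k + 2 ^ k ≤ 16 * 4 ^ u
  k+2^k≤16*4^u u = begin
    k + 2 ^ k          ≤⟨ +-monoˡ-≤ (2 ^ k) (<⇒≤ (n<2^n k)) ⟩
    2 ^ k + 2 ^ k      ≡⟨ cong (2 ^ k +_) (+-identityʳ (2 ^ k)) ⟨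
    2 ^ suc k          ≡⟨ cong (2 ^_) (exponent u) ⟩
    2 ^ (4 + 2 * u)    ≡⟨ ^-distribˡ-+-* 2 4 (2 * u) ⟩
    16 * 2 ^ (2 * u)   ≡⟨ cong (16 *_) (^-*-assoc 2 2 u) ⟨
    16 * 4 ^ u         ∎
    where
    open ≤-Reasoning
    k = suc (suc u + suc u)
    exponent : ∀ u → suc (suc (suc u + suc u)) ≡ 4 + 2 * u
    exponent = solve-∀

  27^2K-dominates : ∀ K → K * 16 ^ (2 * K) ≤ 27 ^ (2 * K)
  27^2K-dominates K = begin
    K * 16 ^ (2 * K)      ≤⟨ *-monoˡ-≤ (16 ^ (2 * K)) (<⇒≤ (n<2^n K)) ⟩
    2 ^ K * 16 ^ (2 * K)  ≡⟨ cong (2 ^ K *_) (^-*-assoc 16 2 K) ⟨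
    2 ^ K * 256 ^ K       ≡⟨ ^-distribʳ-* 2 256 K ⟨
    512 ^ K               ≤⟨ ^-monoˡ-≤ K (≤ᵇ⇒≤ 512 729 _) ⟩
    729 ^ K               ≡⟨ ^-*-assoc 27 2 K ⟩
    27 ^ (2 * K)          ∎
    where open ≤-Reasoning

  log-bound : ∀ K m → m ≤ K * 4 ^ (2 * K) → m * 4 ^ (2 * K) ≤ 27 ^ (2 * K)
  log-bound K m m≤ = begin
    m * 4 ^ (2 * K)                  ≤⟨ *-monoˡ-≤ (4 ^ (2 * K)) m≤ ⟩
    K * 4 ^ (2 * K) * 4 ^ (2 * K)    ≡⟨ *-assoc K _ _ ⟩
    K * (4 ^ (2 * K) * 4 ^ (2 * K))  ≡⟨ cong (K *_) (^-distribʳ-* 4 4 (2 * K)) ⟨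
    K * 16 ^ (2 * K)                 ≤⟨ 27^2K-dominates K ⟩
    27 ^ (2 * K)                     ∎
    where open ≤-Reasoning

  power-bound : ∀ m u Q P → u * Q ≤ P → m * 4 ^ u ≤ 27 ^ u → m ^ Q * 4 ^ P ≤ 27 ^ P
  power-bound m u Q P uQ≤P m4ᵘ≤27ᵘ = subst (λ P → m ^ Q * 4 ^ P ≤ 27 ^ P) (m+[n∸m]≡n uQ≤P) (begin
    m ^ Q * 4 ^ (u * Q + s)          ≡⟨ cong (m ^ Q *_) (^-distribˡ-+-* 4 (u * Q) s) ⟩
    m ^ Q * (4 ^ (u * Q) * 4 ^ s)    ≡⟨ *-assoc (m ^ Q) _ _ ⟨
    m ^ Q * 4 ^ (u * Q) * 4 ^ s      ≡⟨ cong (λ x → m ^ Q * x * 4 ^ s) (^-*-assoc 4 u Q) ⟨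
    m ^ Q * (4 ^ u) ^ Q * 4 ^ s      ≡⟨ cong (_* 4 ^ s) (^-distribʳ-* m (4 ^ u) Q) ⟨
    (m * 4 ^ u) ^ Q * 4 ^ s          ≤⟨ *-mono-≤ (^-monoˡ-≤ Q m4ᵘ≤27ᵘ) (^-monoˡ-≤ s (≤ᵇ⇒≤ 4 27 _)) ⟩
    (27 ^ u) ^ Q * 27 ^ s            ≡⟨ cong (_* 27 ^ s) (^-*-assoc 27 u Q) ⟩
    27 ^ (u * Q) * 27 ^ s            ≡⟨ ^-distribˡ-+-* 27 (u * Q) s ⟨
    27 ^ (u * Q + s)                 ∎)
    where
    open ≤-Reasoning
    s = P ∸ u * Q

  ≡ᵇ-suc-asym : ∀ m n → (n ≡ᵇ suc m) ≡ true → (m ≡ᵇ suc n) ≡ false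
  ≡ᵇ-suc-asym zero    zero    ()
  ≡ᵇ-suc-asym zero    (suc n) _ = refl
  ≡ᵇ-suc-asym (suc m) zero    ()
  ≡ᵇ-suc-asym (suc m) (suc n) e = ≡ᵇ-suc-asym m n e

  module Construction (a₁ a₂ r u : ℕ) where

    -- nB and nF are the least sizes giving v, respectively a vertex of X with t + 1 neighbours in A,
    -- degree qM.
    t k M q nB nF n : ℕ
    t  = suc u
    k  = suc (t + t)
    M  = k + 2 ^ k
    q  = a₁ + a₂ + suc r
    nB = r * M + 2 ^ k
    nF = r * M + suc t
    n  = 1 + (k + (a₁ * M + (a₂ * M + (2 ^ k + (nB + nF)))))

    Vertex : Set
    Vertex = ⊤ ⊎ Fin k ⊎ Fin (a₁ * M) ⊎ Fin (a₂ * M) ⊎ Fin (2 ^ k) ⊎ Fin nB ⊎ Fin nF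

    pattern v    = inj₁ tt
    pattern A a  = inj₂ (inj₁ a)
    pattern W⁺ i = inj₂ (inj₂ (inj₁ i))
    pattern W⁻ i = inj₂ (inj₂ (inj₂ (inj₁ i)))
    pattern X i  = inj₂ (inj₂ (inj₂ (inj₂ (inj₁ i))))
    pattern B i  = inj₂ (inj₂ (inj₂ (inj₂ (inj₂ (inj₁ i)))))
    pattern F i  = inj₂ (inj₂ (inj₂ (inj₂ (inj₂ (inj₂ i)))))

    layout : Fin n ↔ Vertex
    layout = 1↔⊤ ⊕ (↔-refl ⊕ (↔-refl ⊕ (↔-refl ⊕ (↔-refl ⊕ (↔-refl ⊕ ↔-refl)))))

    allows : Vertex → Vertex → Bool
    allows v     (X _) = false
    allows v     (F _) = false
    allows (B _) (X _) = false
    allows (A a) (X i) = agrees t (bits i) a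
    allows _     _     = true

    linked : Vertex → Vertex → Bool
    linked c d = allows c d ∧ allows d c

    -- Arcs go one level up, W⁻ → {v} ∪ X → W⁺; no vertex has level 1, so A, B and F carry no arcs.
    level : Vertex → ℕ
    level (W⁻ _) = 2
    level v      = 3
    level (X _)  = 3
    level (W⁺ _) = 4
    level _      = 0

    towards : Vertex → Vertex → Bool
    towards c d = level d ≡ᵇ suc (level c)

    open BlowUp layout linked towards (λ c d → ∧-comm (allows c d) (allows d c))
                                      (λ c d → ≡ᵇ-suc-asym (level c) (level d)) public

    countB-layout : ∀ (h : Vertex → Bool) → countB (h ∘ class) ≡
      𝟙 (h v) + (countB (h ∘ A) + (countB (h ∘ W⁺) + (countB (h ∘ W⁻) + (countB (h ∘ X) + (countB (h ∘ B) + countB (h ∘ F))))))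
    countB-layout h =
      trans (countB-⊕ 1↔⊤ (↔-refl ⊕ (↔-refl ⊕ (↔-refl ⊕ (↔-refl ⊕ (↔-refl ⊕ ↔-refl))))) h) (cong₂ _+_ (+-identityʳ (𝟙 (h v))) (
      trans (countB-⊕ ↔-refl (↔-refl ⊕ (↔-refl ⊕ (↔-refl ⊕ (↔-refl ⊕ ↔-refl)))) (h ∘ inj₂)) (cong (countB (h ∘ A) +_) (
      trans (countB-⊕ ↔-refl (↔-refl ⊕ (↔-refl ⊕ (↔-refl ⊕ ↔-refl))) (h ∘ inj₂ ∘ inj₂)) (cong (countB (h ∘ W⁺) +_) (
      trans (countB-⊕ ↔-refl (↔-refl ⊕ (↔-refl ⊕ ↔-refl)) (h ∘ inj₂ ∘ inj₂ ∘ inj₂)) (cong (countB (h ∘ W⁻) +_) (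
      trans (countB-⊕ ↔-refl (↔-refl ⊕ ↔-refl) (h ∘ inj₂ ∘ inj₂ ∘ inj₂ ∘ inj₂)) (cong (countB (h ∘ X) +_) (
      countB-⊕ ↔-refl ↔-refl (h ∘ inj₂ ∘ inj₂ ∘ inj₂ ∘ inj₂ ∘ inj₂)))))))))))

    countB-layout-≤ : ∀ (h : Vertex → Bool) {bv bA bW⁺ bW⁻ bX bB bF} →
      𝟙 (h v) ≤ bv → countB (h ∘ A) ≤ bA → countB (h ∘ W⁺) ≤ bW⁺ → countB (h ∘ W⁻) ≤ bW⁻ →
      countB (h ∘ X) ≤ bX → countB (h ∘ B) ≤ bB → countB (h ∘ F) ≤ bF →
      countB (h ∘ class) ≤ bv + (bA + (bW⁺ + (bW⁻ + (bX + (bB + bF)))))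
    countB-layout-≤ h hv hA hW⁺ hW⁻ hX hB hF = ≤-trans (≤-reflexive (countB-layout h))
      (+-mono-≤ hv (+-mono-≤ hA (+-mono-≤ hW⁺ (+-mono-≤ hW⁻ (+-mono-≤ hX (+-mono-≤ hB hF))))))

    countB-layout-≥ : ∀ (h : Vertex → Bool) {bv bA bW⁺ bW⁻ bX bB bF} →
      bv ≤ 𝟙 (h v) → bA ≤ countB (h ∘ A) → bW⁺ ≤ countB (h ∘ W⁺) → bW⁻ ≤ countB (h ∘ W⁻) →
      bX ≤ countB (h ∘ X) → bB ≤ countB (h ∘ B) → bF ≤ countB (h ∘ F) →
      bv + (bA + (bW⁺ + (bW⁻ + (bX + (bB + bF))))) ≤ countB (h ∘ class)
    countB-layout-≥ h hv hA hW⁺ hW⁻ hX hB hF = ≤-trans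
      (+-mono-≤ hv (+-mono-≤ hA (+-mono-≤ hW⁺ (+-mono-≤ hW⁻ (+-mono-≤ hX (+-mono-≤ hB hF))))))
      (≤-reflexive (sym (countB-layout h)))

    private
      full : ∀ {m} {f : Fin m → Bool} → (∀ y → f y ≡ true) → m ≤ countB f
      full all = ≤-reflexive (sym (countB-all all))

      empty : ∀ m → countB {m} (λ _ → false) ≤ 0
      empty m = ≤-reflexive (countB-none {m} (λ _ → refl))

    hub-side-count : ∀ (h : Vertex → Bool) → h v ≡ true → (∀ a → h (A a) ≡ true) → (∀ i → h (W⁺ i) ≡ true) →
      (∀ i → h (W⁻ i) ≡ true) → (∀ i → h (B i) ≡ true) → suc (q * M) ≤ countB (h ∘ class)
    hub-side-count h hv hA hW⁺ hW⁻ hB = ≤-trans (≤-reflexive (identity a₁ a₂ r k (2 ^ k)))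
      (countB-layout-≥ h (≤-reflexive (cong 𝟙 (sym hv))) (full hA) (full hW⁺) (full hW⁻) z≤n (full hB) z≤n)
      where
      identity : ∀ a₁ a₂ r k P → suc ((a₁ + a₂ + suc r) * (k + P)) ≡
        1 + (k + (a₁ * (k + P) + (a₂ * (k + P) + (0 + ((r * (k + P) + P) + 0)))))
      identity = solve-∀

    X-side-count : ∀ (h : Vertex → Bool) → suc t ≤ countB (h ∘ A) → (∀ i → h (W⁺ i) ≡ true) →
      (∀ i → h (W⁻ i) ≡ true) → (∀ i → h (X i) ≡ true) → (∀ i → h (F i) ≡ true) → suc (q * M) ≤ countB (h ∘ class)
    X-side-count h hA hW⁺ hW⁻ hX hF = ≤-trans (≤-reflexive (identity a₁ a₂ r t (2 ^ k)))
      (countB-layout-≥ h z≤n hA (full hW⁺) (full hW⁻) (full hX) z≤n (full hF))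
      where
      identity : ∀ a₁ a₂ r t P → suc ((a₁ + a₂ + suc r) * (suc (t + t) + P)) ≡
        0 + (suc t + (a₁ * (suc (t + t) + P) + (a₂ * (suc (t + t) + P) + (P + (0 + (r * (suc (t + t) + P) + suc t))))))
      identity = solve-∀

    linked-count : ∀ c → suc (q * M) ≤ countB (linked c ∘ class)
    linked-count c@v      = hub-side-count (linked c) refl (λ _ → refl) (λ _ → refl) (λ _ → refl) (λ _ → refl)
    linked-count c@(A _)  = hub-side-count (linked c) refl (λ _ → refl) (λ _ → refl) (λ _ → refl) (λ _ → refl)
    linked-count c@(W⁺ _) = hub-side-count (linked c) refl (λ _ → refl) (λ _ → refl) (λ _ → refl) (λ _ → refl)
    linked-count c@(W⁻ _) = hub-side-count (linked c) refl (λ _ → refl) (λ _ → refl) (λ _ → refl) (λ _ → refl)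
    linked-count c@(B _)  = hub-side-count (linked c) refl (λ _ → refl) (λ _ → refl) (λ _ → refl) (λ _ → refl)
    linked-count c@(X i)  = X-side-count (linked c) (countB-agrees t (bits i)) (λ _ → refl) (λ _ → refl) (λ _ → refl) (λ _ → refl)
    linked-count c@(F _)  = X-side-count (linked c) (≤-trans (s≤s (m≤m+n t t)) (full (λ _ → refl)))
                              (λ _ → refl) (λ _ → refl) (λ _ → refl) (λ _ → refl)

    degree-bound : ∀ x → q * M ≤ deg graph x
    degree-bound x = ≤-pred (≤-trans (linked-count (class x)) (linked-count≤deg x))

    middle-level≤ : ∀ {a} → 1 ≤ a → 1 + (2 ^ k + 0) ≤ a * M
    middle-level≤ {a} a≥1 = begin
      1 + (2 ^ k + 0)  ≤⟨ +-mono-≤ (s≤s (z≤n {t + t})) (≤-reflexive (+-identityʳ (2 ^ k))) ⟩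
      M                ≡⟨ *-identityˡ M ⟨
      1 * M            ≤⟨ *-monoˡ-≤ M a≥1 ⟩
      a * M            ∎
      where open ≤-Reasoning

    out-count : 1 ≤ a₁ → ∀ c → countB (towards c ∘ class) ≤ a₁ * M
    out-count _    c@v      = ≤-trans (countB-layout-≤ (towards c) ≤-refl (empty k) (countB-≤ (a₁ * M)) (empty (a₂ * M))
                                         (empty (2 ^ k)) (empty nB) (empty nF)) (≤-reflexive (+-identityʳ (a₁ * M)))
    out-count _    c@(X _)  = ≤-trans (countB-layout-≤ (towards c) ≤-refl (empty k) (countB-≤ (a₁ * M)) (empty (a₂ * M))
                                         (empty (2 ^ k)) (empty nB) (empty nF)) (≤-reflexive (+-identityʳ (a₁ * M)))
    out-count a₁≥1 c@(W⁻ _) = ≤-trans (countB-layout-≤ (towards c) ≤-refl (empty k) (empty (a₁ * M)) (empty (a₂ * M))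
                                         (countB-≤ (2 ^ k)) (empty nB) (empty nF)) (middle-level≤ a₁≥1)
    out-count _    c@(A _)  = ≤-trans (countB-layout-≤ (towards c) ≤-refl (empty k) (empty (a₁ * M)) (empty (a₂ * M))
                                         (empty (2 ^ k)) (empty nB) (empty nF)) z≤n
    out-count _    c@(W⁺ _) = ≤-trans (countB-layout-≤ (towards c) ≤-refl (empty k) (empty (a₁ * M)) (empty (a₂ * M))
                                         (empty (2 ^ k)) (empty nB) (empty nF)) z≤n
    out-count _    c@(B _)  = ≤-trans (countB-layout-≤ (towards c) ≤-refl (empty k) (empty (a₁ * M)) (empty (a₂ * M))
                                         (empty (2 ^ k)) (empty nB) (empty nF)) z≤n
    out-count _    c@(F _)  = ≤-trans (countB-layout-≤ (towards c) ≤-refl (empty k) (empty (a₁ * M)) (empty (a₂ * M))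
                                         (empty (2 ^ k)) (empty nB) (empty nF)) z≤n

    in-count : 1 ≤ a₂ → ∀ c → countB ((λ d → towards d c) ∘ class) ≤ a₂ * M
    in-count _    c@v      = ≤-trans (countB-layout-≤ (λ d → towards d c) ≤-refl (empty k) (empty (a₁ * M)) (countB-≤ (a₂ * M))
                                        (empty (2 ^ k)) (empty nB) (empty nF)) (≤-reflexive (+-identityʳ (a₂ * M)))
    in-count _    c@(X _)  = ≤-trans (countB-layout-≤ (λ d → towards d c) ≤-refl (empty k) (empty (a₁ * M)) (countB-≤ (a₂ * M))
                                        (empty (2 ^ k)) (empty nB) (empty nF)) (≤-reflexive (+-identityʳ (a₂ * M)))
    in-count a₂≥1 c@(W⁺ _) = ≤-trans (countB-layout-≤ (λ d → towards d c) ≤-refl (empty k) (empty (a₁ * M)) (empty (a₂ * M))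
                                        (countB-≤ (2 ^ k)) (empty nB) (empty nF)) (middle-level≤ a₂≥1)
    in-count _    c@(A _)  = ≤-trans (countB-layout-≤ (λ d → towards d c) ≤-refl (empty k) (empty (a₁ * M)) (empty (a₂ * M))
                                        (empty (2 ^ k)) (empty nB) (empty nF)) z≤n
    in-count _    c@(W⁻ _) = ≤-trans (countB-layout-≤ (λ d → towards d c) ≤-refl (empty k) (empty (a₁ * M)) (empty (a₂ * M))
                                        (empty (2 ^ k)) (empty nB) (empty nF)) z≤n
    in-count _    c@(B _)  = ≤-trans (countB-layout-≤ (λ d → towards d c) ≤-refl (empty k) (empty (a₁ * M)) (empty (a₂ * M))
                                        (empty (2 ^ k)) (empty nB) (empty nF)) z≤n
    in-count _    c@(F _)  = ≤-trans (countB-layout-≤ (λ d → towards d c) ≤-refl (empty k) (empty (a₁ * M)) (empty (a₂ * M))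
                                        (empty (2 ^ k)) (empty nB) (empty nF)) z≤n

    out-degree-bound : 1 ≤ a₁ → ∀ x → outDeg graph x ≤ a₁ * M
    out-degree-bound a₁≥1 x = out-count a₁≥1 (class x)

    in-degree-bound : 1 ≤ a₂ → ∀ x → inDeg graph x ≤ a₂ * M
    in-degree-bound a₂≥1 x = in-count a₂≥1 (class x)

    route-to-hub : ∀ i d → passable (X i) d ≡ true → passable d v ≡ true → ∃[ a ] d ≡ A a × agrees t (bits i) a ≡ true
    route-to-hub i v      () _
    route-to-hub i (A a)  Xa _  = a , refl , Xa
    route-to-hub i (W⁺ _) _  ()
    route-to-hub i (W⁻ _) () _
    route-to-hub i (X _)  _  ()
    route-to-hub i (B _)  () _
    route-to-hub i (F _)  _  ()

    route-from-hub : ∀ i d → passable v d ≡ true → passable d (X i) ≡ true → ∃[ a ] d ≡ A a × agrees t (bits i) a ≡ true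
    route-from-hub i v      _ ()
    route-from-hub i (A a)  _ aX = a , refl , trans (sym (∧-identityʳ _)) aX
    route-from-hub i (W⁺ _) _ ()
    route-from-hub i (W⁻ _) () _
    route-from-hub i (X _)  () _
    route-from-hub i (B _)  _ ()
    route-from-hub i (F _)  () _

    module _ {D : Fin n → Fin n → Bool} (orientation : IsOrientation graph D) where

      hub : Fin n
      hub = vertex v

      colour : Fin k → Bool
      colour a = D hub (vertex (A a))

      private
        X₀ : Vertex
        X₀ = X (code colour)

        passes : ∀ {x y c d} → class x ≡ c → class y ≡ d → D x y ≡ true → passable c d ≡ true
        passes refl refl = passable-step orientation

        witness-agrees : ∀ a → agrees t (bits (code colour)) a ≡ true → colour a ≡ majority t colour
        witness-agrees a agr = begin
          colour a                          ≡⟨ bits-code colour a ⟨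
          bits (code colour) a              ≡⟨ agrees⇒≡majority t (bits (code colour)) a agr ⟩
          majority t (bits (code colour))   ≡⟨ majority-cong t (bits-code colour) ⟩
          majority t colour                 ∎
          where open ≡-Reasoning

        as-vertex : ∀ {w a} → class w ≡ A a → w ≡ vertex (A a)
        as-vertex {w} cw = trans (sym (vertex-class w)) (cong vertex cw)

      no-route-to-hub : majority t colour ≡ true → ¬ DiamLe2 D
      no-route-to-hub maj =
        far-apart⇒¬DiamLe2 (X≢v ∘ vertex-injective) (no-arc ∘ passes (class-vertex X₀) (class-vertex v)) no-detour
        where
        X≢v : X₀ ≢ v
        X≢v ()
        no-arc : passable X₀ v ≢ true
        no-arc ()
        no-detour : ∀ w → D (vertex X₀) w ≡ true → D w hub ≡ true → ⊥
        no-detour w Xw wv with route-to-hub _ (class w) (passes (class-vertex X₀) refl Xw) (passes refl (class-vertex v) wv)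
        ... | a , w∈A , agr = one-way orientation {v} {A a} (λ ()) refl (trans (witness-agrees a agr) maj)
                                (subst (λ z → D z hub ≡ true) (as-vertex w∈A) wv)

      no-route-from-hub : majority t colour ≡ false → ¬ DiamLe2 D
      no-route-from-hub maj =
        far-apart⇒¬DiamLe2 (v≢X ∘ vertex-injective) (no-arc ∘ passes (class-vertex v) (class-vertex X₀)) no-detour
        where
        v≢X : v ≢ X₀
        v≢X ()
        no-arc : passable v X₀ ≢ true
        no-arc ()
        no-detour : ∀ w → D hub w ≡ true → D w (vertex X₀) ≡ true → ⊥
        no-detour w vw wX with route-from-hub _ (class w) (passes (class-vertex v) refl vw) (passes refl (class-vertex X₀) wX)
        ... | a , w∈A , agr
          with () ← trans (sym (trans (witness-agrees a agr) maj)) (subst (λ z → D hub z ≡ true) (as-vertex w∈A) vw)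

    oriented-diameter≥3 : OrientedDiamGe3 graph
    oriented-diameter≥3 D orientation with majority t (colour orientation) in maj
    ... | true  = no-route-to-hub orientation maj
    ... | false = no-route-from-hub orientation maj

    size-identity : n + u ≡ (q + suc r) * M
    size-identity = identity a₁ a₂ r u (2 ^ k)
      where
      identity : ∀ a₁ a₂ r u P → let M = suc (suc u + suc u) + P in
        1 + (suc (suc u + suc u) + (a₁ * M + (a₂ * M + (P + ((r * M + P) + (r * M + suc (suc u))))))) + u ≡
        (a₁ + a₂ + suc r + suc r) * M
      identity = solve-∀

    u≤n : u ≤ n
    u≤n = ≤-trans (m≤m+n u (suc u)) (≤-trans (n≤1+n _) (≤-trans (n≤1+n _) (≤-trans (m≤m+n k _) (n≤1+n _))))

    order-bound : n ≤ 16 * (q + suc r) * 4 ^ u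
    order-bound = begin
      n                            ≤⟨ m≤m+n n u ⟩
      n + u                        ≡⟨ size-identity ⟩
      (q + suc r) * M              ≤⟨ *-monoʳ-≤ (q + suc r) (k+2^k≤16*4^u u) ⟩
      (q + suc r) * (16 * 4 ^ u)   ≡⟨ rearrange (q + suc r) (4 ^ u) ⟩
      16 * (q + suc r) * 4 ^ u     ∎
      where
      open ≤-Reasoning
      rearrange : ∀ a b → a * (16 * b) ≡ 16 * a * b
      rearrange = solve-∀

    scale-by-degree : ∀ {m} a x → m ≤ a * M → m * q ≤ a * deg graph x
    scale-by-degree {m} a x m≤aM = begin
      m * q             ≤⟨ *-monoˡ-≤ q m≤aM ⟩
      a * M * q         ≡⟨ trans (*-assoc a M q) (cong (a *_) (*-comm M q)) ⟩
      a * (q * M)       ≤⟨ *-monoʳ-≤ a (degree-bound x) ⟩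
      a * deg graph x   ∎
      where open ≤-Reasoning


open Combinatorics using (module Construction; power-bound; log-bound)

open import Data.Integer as ℤ using (+_; -[1+_])
import Data.Integer.Properties as ℤ
open import Data.Nat as ℕ using (ℕ; suc; _≥_)
import Data.Nat.Properties as ℕ
import Data.Nat.Coprimality as Coprimality
open import Data.Product using (Σ; ∃; _×_; _,_)
open import Data.Rational using (ℚ; mkℚ; _/_; 0ℚ; 1ℚ; _≤_; _<_; _+_; _*_; _-_; -_; _⊓_; *≤*; *<*; toℚᵘ; Positive; nonNegative)
open import Data.Rational.Properties
open import Data.Rational.Solver using (module +-*-Solver)
import Data.Rational.Unnormalised as ℚᵘ
import Data.Rational.Unnormalised.Properties as ℚᵘ
open import Relation.Binary.PropositionalEquality
open import Function using (_∘_)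

⟦⟧≡mkℚ : ∀ m → ⟦ m ⟧ ≡ mkℚ (+ m) 0 (Coprimality.sym (Coprimality.1-coprimeTo m))
⟦⟧≡mkℚ m = normalize-coprime _

⟦⟧-+ : ∀ m n → ⟦ m ℕ.+ n ⟧ ≡ ⟦ m ⟧ + ⟦ n ⟧
⟦⟧-+ m n rewrite ⟦⟧≡mkℚ m | ⟦⟧≡mkℚ n =
  cong (_/ 1) (trans (ℤ.pos-+ m n) (sym (cong₂ ℤ._+_ (ℤ.*-identityʳ (+ m)) (ℤ.*-identityʳ (+ n)))))

⟦⟧-* : ∀ m n → ⟦ m ℕ.* n ⟧ ≡ ⟦ m ⟧ * ⟦ n ⟧
⟦⟧-* m n rewrite ⟦⟧≡mkℚ m | ⟦⟧≡mkℚ n = cong (_/ 1) (ℤ.pos-* m n)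

⟦⟧-mono-≤ : ∀ {m n} → m ℕ.≤ n → ⟦ m ⟧ ≤ ⟦ n ⟧
⟦⟧-mono-≤ {m} {n} m≤n rewrite ⟦⟧≡mkℚ m | ⟦⟧≡mkℚ n =
  *≤* (subst₂ ℤ._≤_ (sym (ℤ.*-identityʳ (+ m))) (sym (ℤ.*-identityʳ (+ n))) (ℤ.+≤+ m≤n))

⟦⟧-cancel-< : ∀ {m n} → ⟦ m ⟧ < ⟦ n ⟧ → m ℕ.< n
⟦⟧-cancel-< {m} {n} m<n rewrite ⟦⟧≡mkℚ m | ⟦⟧≡mkℚ n with m<n
... | *<* lt = ℤ.drop‿+<+ (subst₂ ℤ._<_ (ℤ.*-identityʳ (+ m)) (ℤ.*-identityʳ (+ n)) lt)

⟦suc⟧-positive : ∀ m → Positive ⟦ suc m ⟧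
⟦suc⟧-positive m rewrite ⟦⟧≡mkℚ (suc m) = _

mkℚ-ratio : ∀ n e .(cop : Coprimality.Coprime n (suc e)) → mkℚ (+ n) e cop * ⟦ suc e ⟧ ≡ ⟦ n ⟧
mkℚ-ratio n e cop = toℚᵘ-injective (ℚᵘ.≃-trans (toℚᵘ-homo-* (mkℚ (+ n) e cop) ⟦ suc e ⟧) cross)
  where
  cross : toℚᵘ (mkℚ (+ n) e cop) ℚᵘ.* toℚᵘ ⟦ suc e ⟧ ℚᵘ.≃ toℚᵘ ⟦ n ⟧
  cross rewrite ⟦⟧≡mkℚ (suc e) | ⟦⟧≡mkℚ n = ℚᵘ.*≡* (trans (ℤ.*-identityʳ _) (trans (ℤ.+◃n≡+n (n ℕ.* suc e))
    (trans (ℤ.pos-* n (suc e)) (cong (λ d → + n ℤ.* + suc d) (sym (ℕ.*-identityʳ e))))))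

open +-*-Solver using (solve; _:+_; _:*_; _:-_; _:=_; con)

≤-by-ratio : ∀ {γ d a} m e .{{_ : Positive ⟦ d ⟧}} → γ * ⟦ d ⟧ ≡ ⟦ a ⟧ → m ℕ.* d ℕ.≤ a ℕ.* e → ⟦ m ⟧ ≤ γ * ⟦ e ⟧
≤-by-ratio {γ} {d} {a} m e ratio le = *-cancelʳ-≤-pos ⟦ d ⟧ (begin
  ⟦ m ⟧ * ⟦ d ⟧       ≡⟨ ⟦⟧-* m d ⟨
  ⟦ m ℕ.* d ⟧         ≤⟨ ⟦⟧-mono-≤ le ⟩
  ⟦ a ℕ.* e ⟧         ≡⟨ ⟦⟧-* a e ⟩
  ⟦ a ⟧ * ⟦ e ⟧       ≡⟨ cong (_* ⟦ e ⟧) ratio ⟨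
  γ * ⟦ d ⟧ * ⟦ e ⟧   ≡⟨ solve 3 (λ γ d e → γ :* d :* e := γ :* e :* d) refl γ ⟦ d ⟧ ⟦ e ⟧ ⟩
  γ * ⟦ e ⟧ * ⟦ d ⟧   ∎)
  where open ≤-Reasoning

ratio-* : ∀ {γ d a} e → γ * ⟦ d ⟧ ≡ ⟦ a ⟧ → γ * ⟦ d ℕ.* e ⟧ ≡ ⟦ a ℕ.* e ⟧
ratio-* {γ} {d} {a} e ratio = begin
  γ * ⟦ d ℕ.* e ⟧       ≡⟨ cong (γ *_) (⟦⟧-* d e) ⟩
  γ * (⟦ d ⟧ * ⟦ e ⟧)   ≡⟨ *-assoc γ ⟦ d ⟧ ⟦ e ⟧ ⟨
  γ * ⟦ d ⟧ * ⟦ e ⟧     ≡⟨ cong (_* ⟦ e ⟧) ratio ⟩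
  ⟦ a ⟧ * ⟦ e ⟧         ≡⟨ ⟦⟧-* a e ⟨
  ⟦ a ℕ.* e ⟧           ∎
  where open ≡-Reasoning

ratio-+ : ∀ {γ γ′ d a b} → γ * ⟦ d ⟧ ≡ ⟦ a ⟧ → γ′ * ⟦ d ⟧ ≡ ⟦ b ⟧ → (γ + γ′) * ⟦ d ⟧ ≡ ⟦ a ℕ.+ b ⟧
ratio-+ {γ} {γ′} {d} {a} {b} ratio ratio′ =
  trans (*-distribʳ-+ ⟦ d ⟧ γ γ′) (trans (cong₂ _+_ ratio ratio′) (sym (⟦⟧-+ a b)))

<-by-ratio : ∀ {γ γ′ d a b} .{{_ : Positive ⟦ d ⟧}} → γ * ⟦ d ⟧ ≡ ⟦ a ⟧ → γ′ * ⟦ d ⟧ ≡ ⟦ b ⟧ → γ < γ′ → a ℕ.< b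
<-by-ratio {d = d} ratio ratio′ γ<γ′ = ⟦⟧-cancel-< (subst₂ _<_ ratio ratio′ (*-monoˡ-<-pos ⟦ d ⟧ γ<γ′))

≤-by-sum : ∀ m u {x} → ⟦ m ℕ.+ u ⟧ ≤ x → ⟦ u ⟧ ≤ x - ⟦ m ⟧
≤-by-sum m u {x} m+u≤x = begin
  ⟦ u ⟧                 ≡⟨ solve 2 (λ m u → u := m :+ u :- m) refl ⟦ m ⟧ ⟦ u ⟧ ⟩
  ⟦ m ⟧ + ⟦ u ⟧ - ⟦ m ⟧ ≡⟨ cong (_- ⟦ m ⟧) (⟦⟧-+ m u) ⟨
  ⟦ m ℕ.+ u ⟧ - ⟦ m ⟧   ≤⟨ +-monoˡ-≤ (- ⟦ m ⟧) m+u≤x ⟩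
  x - ⟦ m ⟧             ∎
  where open ≤-Reasoning

record Ratios (c₁ c₂ : ℚ) : Set where
  field
    a₁ a₂ r  : ℕ
    1≤a₁     : 1 ℕ.≤ a₁
    1≤a₂     : 1 ℕ.≤ a₂
    c₁-ratio : c₁ * ⟦ a₁ ℕ.+ a₂ ℕ.+ suc r ⟧ ≡ ⟦ a₁ ⟧
    c₂-ratio : c₂ * ⟦ a₁ ℕ.+ a₂ ℕ.+ suc r ⟧ ≡ ⟦ a₂ ⟧

  q : ℕ
  q = a₁ ℕ.+ a₂ ℕ.+ suc r

  instance
    q-positive : Positive ⟦ q ⟧
    q-positive = subst (Positive ∘ ⟦_⟧) (sym (ℕ.+-suc (a₁ ℕ.+ a₂) r)) (⟦suc⟧-positive (a₁ ℕ.+ a₂ ℕ.+ r))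

  slack-ratio : (⟦ 2 ⟧ - c₁ - c₂) * ⟦ q ⟧ ≡ ⟦ q ℕ.+ suc r ⟧
  slack-ratio = begin
    (⟦ 2 ⟧ - c₁ - c₂) * ⟦ q ⟧
      ≡⟨ solve 4 (λ t c₁ c₂ Q → (t :- c₁ :- c₂) :* Q := t :* Q :- c₁ :* Q :- c₂ :* Q) refl ⟦ 2 ⟧ c₁ c₂ ⟦ q ⟧ ⟩
    ⟦ 2 ⟧ * ⟦ q ⟧ - c₁ * ⟦ q ⟧ - c₂ * ⟦ q ⟧
      ≡⟨ cong₂ (λ x y → ⟦ 2 ⟧ * ⟦ q ⟧ - x - y) c₁-ratio c₂-ratio ⟩
    ⟦ 2 ⟧ * ⟦ q ⟧ - ⟦ a₁ ⟧ - ⟦ a₂ ⟧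
      ≡⟨ cong (λ Q → ⟦ 2 ⟧ * Q - ⟦ a₁ ⟧ - ⟦ a₂ ⟧) q-split ⟩
    ⟦ 2 ⟧ * (⟦ a₁ ⟧ + ⟦ a₂ ⟧ + ⟦ suc r ⟧) - ⟦ a₁ ⟧ - ⟦ a₂ ⟧
      ≡⟨ solve 3 (λ a₁ a₂ s → (con 1ℚ :+ con 1ℚ) :* (a₁ :+ a₂ :+ s) :- a₁ :- a₂ := a₁ :+ a₂ :+ s :+ s) refl ⟦ a₁ ⟧ ⟦ a₂ ⟧ ⟦ suc r ⟧ ⟩
    ⟦ a₁ ⟧ + ⟦ a₂ ⟧ + ⟦ suc r ⟧ + ⟦ suc r ⟧
      ≡⟨ cong (_+ ⟦ suc r ⟧) q-split ⟨
    ⟦ q ⟧ + ⟦ suc r ⟧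
      ≡⟨ ⟦⟧-+ q (suc r) ⟨
    ⟦ q ℕ.+ suc r ⟧ ∎
    where
    open ≡-Reasoning
    q-split : ⟦ q ⟧ ≡ ⟦ a₁ ⟧ + ⟦ a₂ ⟧ + ⟦ suc r ⟧
    q-split = trans (⟦⟧-+ (a₁ ℕ.+ a₂) (suc r)) (cong (_+ ⟦ suc r ⟧) (⟦⟧-+ a₁ a₂))

ratios : ∀ {c₁ c₂} → 0ℚ < c₁ × 0ℚ < c₂ × c₁ + c₂ < 1ℚ → Ratios c₁ c₂
ratios {mkℚ -[1+ _ ] _ _} (*<* () , _)
ratios {mkℚ (+ _) _ _} {mkℚ -[1+ _ ] _ _} (_ , *<* () , _)
ratios {c₁@(mkℚ (+ n₁) e₁ cop₁)} {c₂@(mkℚ (+ n₂) e₂ cop₂)} (0<c₁ , 0<c₂ , c₁+c₂<1) = record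
  { a₁ = a₁ ; a₂ = a₂ ; r = d ℕ.∸ suc (a₁ ℕ.+ a₂)
  ; 1≤a₁ = <-by-ratio {d = d} {a = 0} (*-zeroˡ ⟦ d ⟧) c₁-ratio 0<c₁
  ; 1≤a₂ = <-by-ratio {d = d} {a = 0} (*-zeroˡ ⟦ d ⟧) c₂-ratio 0<c₂
  ; c₁-ratio = subst (λ x → c₁ * ⟦ x ⟧ ≡ ⟦ a₁ ⟧) (sym q≡d) c₁-ratio
  ; c₂-ratio = subst (λ x → c₂ * ⟦ x ⟧ ≡ ⟦ a₂ ⟧) (sym q≡d) c₂-ratio
  }
  where
  d a₁ a₂ : ℕ
  d  = suc e₁ ℕ.* suc e₂
  a₁ = n₁ ℕ.* suc e₂
  a₂ = n₂ ℕ.* suc e₁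
  instance
    d-positive : Positive ⟦ d ⟧
    d-positive = ⟦suc⟧-positive (e₂ ℕ.+ e₁ ℕ.* suc e₂)
  c₁-ratio : c₁ * ⟦ d ⟧ ≡ ⟦ a₁ ⟧
  c₁-ratio = ratio-* {c₁} {suc e₁} {n₁} (suc e₂) (mkℚ-ratio n₁ e₁ cop₁)
  c₂-ratio : c₂ * ⟦ d ⟧ ≡ ⟦ a₂ ⟧
  c₂-ratio = subst (λ x → c₂ * ⟦ x ⟧ ≡ ⟦ a₂ ⟧) (ℕ.*-comm (suc e₂) (suc e₁))
               (ratio-* {c₂} {suc e₂} {n₂} (suc e₁) (mkℚ-ratio n₂ e₂ cop₂))
  q≡d : a₁ ℕ.+ a₂ ℕ.+ suc (d ℕ.∸ suc (a₁ ℕ.+ a₂)) ≡ d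
  q≡d = trans (ℕ.+-suc (a₁ ℕ.+ a₂) _) (ℕ.m+[n∸m]≡n a₁+a₂<d)
    where
    a₁+a₂<d : a₁ ℕ.+ a₂ ℕ.< d
    a₁+a₂<d = <-by-ratio {d = d} (ratio-+ {c₁} {c₂} {d} {a₁} {a₂} c₁-ratio c₂-ratio) (*-identityˡ ⟦ d ⟧) c₁+c₂<1

parameters-positive : ∀ c₁ c₂ → 0ℚ < (c₁ ⊓ c₂) * (⟦ 2 ⟧ - c₁ - c₂) → (c₁ ⊓ c₂) * (⟦ 2 ⟧ - c₁ - c₂) ≤ 1ℚ - c₁ - c₂ →
  0ℚ < c₁ × 0ℚ < c₂ × c₁ + c₂ < 1ℚ
parameters-positive c₁ c₂ 0<cX cX≤slack = <-≤-trans 0<c (p⊓q≤p c₁ c₂) , <-≤-trans 0<c (p⊓q≤q c₁ c₂) , c₁+c₂<1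
  where
  0<slack : 0ℚ < 1ℚ - c₁ - c₂
  0<slack = <-≤-trans 0<cX cX≤slack
  c₁+c₂<1 : c₁ + c₂ < 1ℚ
  c₁+c₂<1 = subst₂ _<_ (+-identityˡ (c₁ + c₂)) (solve 2 (λ c₁ c₂ → con 1ℚ :- c₁ :- c₂ :+ (c₁ :+ c₂) := con 1ℚ) refl c₁ c₂)
                       (+-monoˡ-< (c₁ + c₂) 0<slack)
  0≤X : 0ℚ ≤ ⟦ 2 ⟧ - c₁ - c₂
  0≤X = subst (0ℚ ≤_) (solve 2 (λ c₁ c₂ → con 1ℚ :+ (con 1ℚ :- c₁ :- c₂) := (con 1ℚ :+ con 1ℚ) :- c₁ :- c₂) refl c₁ c₂)
                      (+-mono-≤ (⟦⟧-mono-≤ {0} {1} ℕ.z≤n) (<⇒≤ 0<slack))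
  0<c : 0ℚ < c₁ ⊓ c₂
  0<c = *-cancelʳ-<-nonNeg (⟦ 2 ⟧ - c₁ - c₂) {{nonNegative 0≤X}}
          (subst (_< (c₁ ⊓ c₂) * (⟦ 2 ⟧ - c₁ - c₂)) (sym (*-zeroˡ (⟦ 2 ⟧ - c₁ - c₂))) 0<cX)

GeLog-intro : ∀ {x u m} → ⟦ u ⟧ ≤ x → m ℕ.* 4 ℕ.^ u ℕ.≤ 27 ℕ.^ u → GeLog x m
GeLog-intro {mkℚ -[1+ _ ] _ _} {u} u≤x _ with ≤-trans (⟦⟧-mono-≤ {0} {u} ℕ.z≤n) u≤x
... | *≤* ()
GeLog-intro {x@(mkℚ (+ p) e _)} {u} {m} u≤x bound =
  ≤-trans (⟦⟧-mono-≤ {0} {u} ℕ.z≤n) u≤x , power-bound m u (suc e) p (uQ≤p u≤x) bound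
  where
  uQ≤p : ⟦ u ⟧ ≤ x → u ℕ.* suc e ℕ.≤ p
  uQ≤p u≤x rewrite ⟦⟧≡mkℚ u with u≤x
  ... | *≤* le = ℤ.drop‿+≤+ (subst₂ ℤ._≤_ (sym (ℤ.pos-* u (suc e))) (ℤ.*-identityʳ (+ p)) le)

lemma2p2 : (c₁ c₂ : ℚ) → 0ℚ ≤ c₁ → c₁ ≤ 1ℚ → 0ℚ ≤ c₂ → c₂ ≤ 1ℚ →
    0ℚ < (c₁ ⊓ c₂) * (⟦ 2 ⟧ - c₁ - c₂) →
    (c₁ ⊓ c₂) * (⟦ 2 ⟧ - c₁ - c₂) ≤ 1ℚ - c₁ - c₂ →
    (N : ℕ) → Σ ℕ λ n → (n ≥ N) × Σ (MixedGraph n) λ G →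
      IsMixed G c₁ c₂ × MinDegBound G c₁ c₂ × OrientedDiamGe3 G
lemma2p2 c₁ c₂ _ _ _ _ 0<cX cX≤slack N = n , N≤n , graph , mixed , min-degree , oriented-diameter≥3
  where
  open Ratios (ratios (parameters-positive c₁ c₂ 0<cX cX≤slack)) hiding (q)
  K u : ℕ
  K = 16 ℕ.* (a₁ ℕ.+ a₂ ℕ.+ suc r ℕ.+ suc r) ℕ.+ N
  u = 2 ℕ.* K
  open Construction a₁ a₂ r u

  N≤n : n ≥ N
  N≤n = ℕ.≤-trans (ℕ.m≤n+m N _) (ℕ.≤-trans (ℕ.m≤m+n K _) u≤n)

  mixed : IsMixed graph c₁ c₂
  mixed x =
    ≤-by-ratio {c₁} {q} {a₁} (outDeg graph x) (deg graph x) c₁-ratio (scale-by-degree a₁ x (out-degree-bound 1≤a₁ x)) ,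
    ≤-by-ratio {c₂} {q} {a₂} (inDeg graph x) (deg graph x) c₂-ratio (scale-by-degree a₂ x (in-degree-bound 1≤a₂ x))

  min-degree : MinDegBound graph c₁ c₂
  min-degree x = GeLog-intro {u = u} (≤-by-sum n u slack) (log-bound K n n≤K4ᵘ)
    where
    slack : ⟦ n ℕ.+ u ⟧ ≤ (⟦ 2 ⟧ - c₁ - c₂) * ⟦ deg graph x ⟧
    slack = ≤-by-ratio {⟦ 2 ⟧ - c₁ - c₂} {q} {q ℕ.+ suc r} (n ℕ.+ u) (deg graph x) slack-ratio
              (scale-by-degree (q ℕ.+ suc r) x (ℕ.≤-reflexive size-identity))
    n≤K4ᵘ : n ℕ.≤ K ℕ.* 4 ℕ.^ u
    n≤K4ᵘ = ℕ.≤-trans order-bound (ℕ.*-monoˡ-≤ (4 ℕ.^ u) (ℕ.m≤m+n (16 ℕ.* (q ℕ.+ suc r)) N))
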